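{- Let $k \in \mathbb{Z}$, $r\in\mathbb{Z}$ and $n \geq 0$. Then \begin{equation*} C_{n}^{(k)}(x)=\sum_{m=0}^{n}\left\{(-1)^{m}\sum_{l=0}^{n-m}\sum_{a=0}^{n-m-l}\binom{n}{l+m}\binom{n-m-l}{a} S_{1}(l+m,m)\beta_{a}^{(r)}(-r)C_{n-m-l-a}^{(k)} \right\}B_{m}^{(r)}(x). \end{equation*}
   Context: For $k\in\mathbb{Z}$, $Lif_k(t)=\sum_{m=0}^{\infty}\frac{t^m}{m!(m+1)^k}$; the poly-Cauchy polynomials are defined by $\frac{Lif_k(\log(1+t))}{(1+t)^x}=\sum_{n\ge0} C_n^{(k)}(x)\frac{t^n}{n!}$ and $C_n^{(k)}=C_n^{(k)}(0)$. The Stirling numbers of the first kind are defined by $(\log(1+t))^m=m!\sum_{l\ge m}S_1(l,m)\frac{t^l}{l!}$. The Bernoulli polynomials of order $r$ are defined by $\left(\frac{t}{e^t-1}\right)^r e^{xt}=\sum_{n\ge0}B_n^{(r)}(x)\frac{t^n}{n!}$. Carlitz's polynomials $\beta_n^{(r)}(x)$ are defined by $\left(\frac{t}{\log(1+t)}\right)^r(1+t)^x=\sum_{n\ge0}\beta_n^{(r)}(x)\frac{t^n}{n!}$. -}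

module Defs where

open import Data.Nat as ℕ using (ℕ; zero; suc; _∸_)
open import Data.Nat.Combinatorics using (_C_)
open import Data.Integer as ℤ using (ℤ; +_; -[1+_])
open import Data.Rational using (ℚ; _/_; 0ℚ; 1ℚ; _+_; _*_; -_; _-_)

ℤ→ℚ : ℤ → ℚ
ℤ→ℚ z = z / 1

ℕ→ℚ : ℕ → ℚ
ℕ→ℚ n = (+ n) / 1

-- 1/n for n ≥ 1 (junk value 0 at n = 0, never used)
invℕ : ℕ → ℚ
invℕ zero    = 0ℚ
invℕ (suc n) = (+ 1) / suc n

_^ℚ_ : ℚ → ℕ → ℚ
q ^ℚ zero  = 1ℚ
q ^ℚ suc n = q * (q ^ℚ n)

negOnePow : ℕ → ℚ
negOnePow zero    = 1ℚ
negOnePow (suc n) = - negOnePow n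

fact : ℕ → ℚ
fact n = ℕ→ℚ (n ℕ.!)

sumTo : ℕ → (ℕ → ℚ) → ℚ
sumTo zero    f = f 0
sumTo (suc n) f = sumTo n f + f (suc n)

-- Formal power series over ℚ, as coefficient sequences: F n = [t^n] F

FPS : Set
FPS = ℕ → ℚ

one : FPS
one zero    = 1ℚ
one (suc n) = 0ℚ

_⊕_ : FPS → FPS → FPS
(f ⊕ g) n = f n + g n

_⊖_ : FPS → FPS → FPS
(f ⊖ g) n = f n - g n

_⊛_ : FPS → FPS → FPS
(f ⊛ g) n = sumTo n (λ i → f i * g (n ∸ i))

_^F_ : FPS → ℕ → FPS
f ^F zero  = one
f ^F suc m = f ⊛ (f ^F m)

-- composition F(g(t)) for g with g 0 = 0 (only meaningful then):
-- [t^n] F(g) = Σ_{m=0}^{n} F_m [t^n] g^m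
compose : FPS → FPS → FPS
compose F g n = sumTo n (λ m → F m * (g ^F m) n)

geom : FPS
geom _ = 1ℚ

-- multiplicative inverse of a series with constant term 1:  1/a = geom(1 - a)
inv1 : FPS → FPS
inv1 a = compose geom (one ⊖ a)

-- integer power of a series with constant term 1
_^ℤF_ : FPS → ℤ → FPS
a ^ℤF (+ n)     = a ^F n
a ^ℤF -[1+ n ]  = (inv1 a) ^F (suc n)

log1p : FPS
log1p zero    = 0ℚ
log1p (suc n) = negOnePow n * invℕ (suc n)

logOverT : FPS
logOverT n = negOnePow n * invℕ (suc n)

expm1OverT : FPS
expm1OverT n = invℕ (suc n ℕ.!)

expX : ℚ → FPS
expX x n = (x ^ℚ n) * invℕ (n ℕ.!)

-- (1+t)^x = Σ_n binom(x,n) t^n, binom(x,n) = x(x-1)...(x-n+1)/n!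
fallingℚ : ℚ → ℕ → ℚ
fallingℚ x zero    = 1ℚ
fallingℚ x (suc n) = fallingℚ x n * (x - ℕ→ℚ n)

onePlusTPow : ℚ → FPS
onePlusTPow x n = fallingℚ x n * invℕ (n ℕ.!)

recipPowℤ : ℕ → ℤ → ℚ
recipPowℤ m (+ k)     = invℕ (suc m ℕ.^ k)
recipPowℤ m -[1+ k ]  = ℕ→ℚ (suc m ℕ.^ suc k)

Lif : ℤ → FPS
Lif k m = invℕ (m ℕ.!) * recipPowℤ m k

-- poly-Cauchy polynomials: Lif_k(log(1+t)) / (1+t)^x = Σ C_n^{(k)}(x) t^n/n!
CauchyPoly : ℤ → ℕ → ℚ → ℚ
CauchyPoly k n x = fact n * (compose (Lif k) log1p ⊛ onePlusTPow (- x)) n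

Cauchy : ℤ → ℕ → ℚ
Cauchy k n = CauchyPoly k n 0ℚ

-- Stirling numbers of the first kind:
-- (log(1+t))^m = m! Σ_{l≥m} S1(l,m) t^l / l!
S₁ : ℕ → ℕ → ℚ
S₁ l m = fact l * invℕ (m ℕ.!) * (log1p ^F m) l

-- Bernoulli polynomials of order r:  (t/(e^t-1))^r e^{xt} = Σ B_n^{(r)}(x) t^n/n!
-- t/(e^t-1) = ((e^t-1)/t)^{-1}, so (t/(e^t-1))^r = ((e^t-1)/t)^{-r}
BernoulliPoly : ℤ → ℕ → ℚ → ℚ
BernoulliPoly r n x = fact n * ((expm1OverT ^ℤF (ℤ.- r)) ⊛ expX x) n

-- Carlitz's polynomials:  (t/log(1+t))^r (1+t)^x = Σ β_n^{(r)}(x) t^n/n!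
CarlitzBeta : ℤ → ℕ → ℚ → ℚ
CarlitzBeta r n x = fact n * ((logOverT ^ℤF (ℤ.- r)) ⊛ onePlusTPow x) n

-- Write L = log(1 + t). Since e^{-xL} = (1 + t)^{-x}, substituting t ↦ -L into the generating
-- function (t/(e^t - 1))^r e^{xt} of B_m^{(r)}(x) gives ((1 + t)L/t)^r (1 + t)^{-x}, and the first
-- factor is the reciprocal of (t/L)^r (1 + t)^{-r}, the generating function of β_n^{(r)}(-r). Hence
--   Lif_k(L) (1 + t)^{-x} = Σ_m B_m^{(r)}(x) (-L)^m/m! · Σ_n β_n^{(r)}(-r) t^n/n! · Σ_n C_n^{(k)} t^n/n!,
-- and expanding (-L)^m/m! = (-1)^m Σ_l S₁(l, m) t^l/l! and comparing coefficients of t^n/n! gives the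
-- formula. All of this happens in ℚ[[t]], where exponentials of series are recognised as binomial
-- series (1 + t)^c through the differential equation (1 + t) f′ = c f, which determines f from f(0).

module Submission where

open import Data.Empty using (⊥-elim)
open import Data.Integer as ℤ using (ℤ; +_; -[1+_])
import Data.Integer.Properties as ℤP
open import Data.Nat as ℕ using (ℕ; zero; suc; _+_; _∸_; _≤_; _<_; z≤n; s≤s; NonZero)
open import Data.Nat.Combinatorics using (_C_)
import Data.Nat.Combinatorics as ℕC
import Data.Nat.DivMod as ℕD
import Data.Nat.Properties as ℕP
open import Data.Rational using (ℚ; 0ℚ; 1ℚ; _*_; -_; toℚᵘ)
  renaming (_+_ to _+ℚ_; _-_ to _-ℚ_)
import Data.Rational.Properties as ℚP
open import Data.Rational.Solver using (module +-*-Solver)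
import Data.Rational.Unnormalised as ℚᵘ
import Data.Rational.Unnormalised.Properties as ℚᵘP
open import Relation.Binary.PropositionalEquality
  using (_≡_; refl; sym; trans; cong; cong₂; subst; _≗_; _→-setoid_; module ≡-Reasoning)
open import Relation.Binary.Bundles using (Setoid)
import Relation.Binary.Reasoning.Setoid as SetoidReasoning
open import Relation.Nullary using (yes; no)
open import Defs
open +-*-Solver

toℚᵘ-ℕ→ℚ : ∀ n → toℚᵘ (ℕ→ℚ n) ℚᵘ.≃ ℚᵘ.mkℚᵘ (+ n) 0
toℚᵘ-ℕ→ℚ n = ℚP.toℚᵘ-fromℚᵘ (ℚᵘ.mkℚᵘ (+ n) 0)

ℕ→ℚ-homo-+ : ∀ m n → ℕ→ℚ (m + n) ≡ ℕ→ℚ m +ℚ ℕ→ℚ n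
ℕ→ℚ-homo-+ m n = ℚP.toℚᵘ-injective (ℚᵘP.≃-trans (toℚᵘ-ℕ→ℚ (m + n))
  (ℚᵘP.≃-trans (ℚᵘ.*≡* (cong (ℤ._* + 1) +m+n≡))
  (ℚᵘP.≃-sym (ℚᵘP.≃-trans (ℚP.toℚᵘ-homo-+ (ℕ→ℚ m) (ℕ→ℚ n))
    (ℚᵘP.+-cong (toℚᵘ-ℕ→ℚ m) (toℚᵘ-ℕ→ℚ n))))))
  where
  +m+n≡ : + (m + n) ≡ + m ℤ.* + 1 ℤ.+ + n ℤ.* + 1
  +m+n≡ = trans (ℤP.pos-+ m n) (sym (cong₂ ℤ._+_ (ℤP.*-identityʳ (+ m)) (ℤP.*-identityʳ (+ n))))

ℕ→ℚ-homo-* : ∀ m n → ℕ→ℚ (m ℕ.* n) ≡ ℕ→ℚ m * ℕ→ℚ n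
ℕ→ℚ-homo-* m n = ℚP.toℚᵘ-injective (ℚᵘP.≃-trans (toℚᵘ-ℕ→ℚ (m ℕ.* n))
  (ℚᵘP.≃-trans (ℚᵘ.*≡* (cong (ℤ._* + 1) (ℤP.pos-* m n)))
  (ℚᵘP.≃-sym (ℚᵘP.≃-trans (ℚP.toℚᵘ-homo-* (ℕ→ℚ m) (ℕ→ℚ n))
    (ℚᵘP.*-cong (toℚᵘ-ℕ→ℚ m) (toℚᵘ-ℕ→ℚ n))))))

ℕ→ℚ-*-invℕ : ∀ n .{{_ : NonZero n}} → ℕ→ℚ n * invℕ n ≡ 1ℚ
ℕ→ℚ-*-invℕ (suc n) = ℚP.toℚᵘ-injective (ℚᵘP.≃-trans (ℚP.toℚᵘ-homo-* (ℕ→ℚ (suc n)) (invℕ (suc n)))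
  (ℚᵘP.≃-trans (ℚᵘP.*-cong (toℚᵘ-ℕ→ℚ (suc n)) (ℚP.toℚᵘ-fromℚᵘ (ℚᵘ.mkℚᵘ (+ 1) n)))
  (ℚᵘ.*≡* (trans (ℤP.*-identityʳ _) (trans (ℤP.*-identityʳ (+ suc n))
    (sym (trans (ℤP.*-identityˡ _) (ℤP.*-identityˡ (+ suc n)))))))))

ℤ→ℚ-neg : ∀ z → ℤ→ℚ (ℤ.- z) ≡ - ℤ→ℚ z
ℤ→ℚ-neg (+ zero)  = refl
ℤ→ℚ-neg (+ suc n) = refl
ℤ→ℚ-neg -[1+ n ]  = solve 1 (λ a → a := :- (:- a)) refl (ℕ→ℚ (suc n))

*-inverseʳ-unique : ∀ q x y → q * x ≡ 1ℚ → q * y ≡ 1ℚ → x ≡ y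
*-inverseʳ-unique q x y qx≡1 qy≡1 = begin
  x            ≡⟨ sym (ℚP.*-identityʳ x) ⟩
  x * 1ℚ       ≡⟨ cong (x *_) (sym qy≡1) ⟩
  x * (q * y)  ≡⟨ sym (ℚP.*-assoc x q y) ⟩
  (x * q) * y  ≡⟨ cong (_* y) (trans (ℚP.*-comm x q) qx≡1) ⟩
  1ℚ * y       ≡⟨ ℚP.*-identityˡ y ⟩
  y            ∎
  where open ≡-Reasoning

invℕ-homo-* : ∀ m n .{{_ : NonZero m}} .{{_ : NonZero n}} → invℕ (m ℕ.* n) ≡ invℕ m * invℕ n
invℕ-homo-* m n = *-inverseʳ-unique (ℕ→ℚ (m ℕ.* n)) _ _ (ℕ→ℚ-*-invℕ (m ℕ.* n) {{ℕP.m*n≢0 m n}}) (begin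
  ℕ→ℚ (m ℕ.* n) * (invℕ m * invℕ n)      ≡⟨ cong (_* (invℕ m * invℕ n)) (ℕ→ℚ-homo-* m n) ⟩
  ℕ→ℚ m * ℕ→ℚ n * (invℕ m * invℕ n)      ≡⟨ solve 4 (λ a b c d → (a :* b) :* (c :* d) := (a :* c) :* (b :* d))
                                               refl (ℕ→ℚ m) (ℕ→ℚ n) (invℕ m) (invℕ n) ⟩
  (ℕ→ℚ m * invℕ m) * (ℕ→ℚ n * invℕ n)    ≡⟨ cong₂ _*_ (ℕ→ℚ-*-invℕ m) (ℕ→ℚ-*-invℕ n) ⟩
  1ℚ * 1ℚ                                ∎)
  where open ≡-Reasoning

fact-*-invℕ-! : ∀ n → fact n * invℕ (n ℕ.!) ≡ 1ℚ
fact-*-invℕ-! n = ℕ→ℚ-*-invℕ (n ℕ.!) {{ℕP._!≢0 n}}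

ℕ→ℚ-suc-*-invℕ-suc-! : ∀ n → ℕ→ℚ (suc n) * invℕ (suc n ℕ.!) ≡ invℕ (n ℕ.!)
ℕ→ℚ-suc-*-invℕ-suc-! n = begin
  ℕ→ℚ (suc n) * invℕ (suc n ℕ.* n ℕ.!)
    ≡⟨ cong (ℕ→ℚ (suc n) *_) (invℕ-homo-* (suc n) (n ℕ.!) {{_}} {{ℕP._!≢0 n}}) ⟩
  ℕ→ℚ (suc n) * (invℕ (suc n) * invℕ (n ℕ.!))
    ≡⟨ sym (ℚP.*-assoc (ℕ→ℚ (suc n)) (invℕ (suc n)) (invℕ (n ℕ.!))) ⟩
  (ℕ→ℚ (suc n) * invℕ (suc n)) * invℕ (n ℕ.!)
    ≡⟨ cong (_* invℕ (n ℕ.!)) (ℕ→ℚ-*-invℕ (suc n)) ⟩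
  1ℚ * invℕ (n ℕ.!)
    ≡⟨ ℚP.*-identityˡ (invℕ (n ℕ.!)) ⟩
  invℕ (n ℕ.!) ∎
  where open ≡-Reasoning

ℕ→ℚ-suc-*-cancelˡ : ∀ n {x y} → ℕ→ℚ (suc n) * x ≡ ℕ→ℚ (suc n) * y → x ≡ y
ℕ→ℚ-suc-*-cancelˡ n {x} {y} eq = begin
  x                             ≡⟨ sym (ℚP.*-identityˡ x) ⟩
  1ℚ * x                        ≡⟨ cong (_* x) (sym inv*n≡1) ⟩
  (invℕ (suc n) * ℕ→ℚ (suc n)) * x ≡⟨ ℚP.*-assoc (invℕ (suc n)) _ x ⟩
  invℕ (suc n) * (ℕ→ℚ (suc n) * x) ≡⟨ cong (invℕ (suc n) *_) eq ⟩
  invℕ (suc n) * (ℕ→ℚ (suc n) * y) ≡⟨ sym (ℚP.*-assoc (invℕ (suc n)) _ y) ⟩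
  (invℕ (suc n) * ℕ→ℚ (suc n)) * y ≡⟨ cong (_* y) inv*n≡1 ⟩
  1ℚ * y                        ≡⟨ ℚP.*-identityˡ y ⟩
  y                             ∎
  where
  open ≡-Reasoning
  inv*n≡1 : invℕ (suc n) * ℕ→ℚ (suc n) ≡ 1ℚ
  inv*n≡1 = trans (ℚP.*-comm (invℕ (suc n)) (ℕ→ℚ (suc n))) (ℕ→ℚ-*-invℕ (suc n))

C-*-!-*-! : ∀ n a → a ≤ n → ℕ→ℚ (n C a) * fact a * fact (n ∸ a) ≡ fact n
C-*-!-*-! n a a≤n = begin
  ℕ→ℚ (n C a) * fact a * fact (n ∸ a)
    ≡⟨ ℚP.*-assoc (ℕ→ℚ (n C a)) (fact a) (fact (n ∸ a)) ⟩
  ℕ→ℚ (n C a) * (fact a * fact (n ∸ a))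
    ≡⟨ cong (ℕ→ℚ (n C a) *_) (sym (ℕ→ℚ-homo-* (a ℕ.!) ((n ∸ a) ℕ.!))) ⟩
  ℕ→ℚ (n C a) * ℕ→ℚ (a ℕ.! ℕ.* (n ∸ a) ℕ.!)
    ≡⟨ sym (ℕ→ℚ-homo-* (n C a) _) ⟩
  ℕ→ℚ ((n C a) ℕ.* (a ℕ.! ℕ.* (n ∸ a) ℕ.!))
    ≡⟨ cong ℕ→ℚ nCa*a!*[n-a]!≡n! ⟩
  fact n ∎
  where
  open ≡-Reasoning
  nCa*a!*[n-a]!≡n! : (n C a) ℕ.* (a ℕ.! ℕ.* (n ∸ a) ℕ.!) ≡ n ℕ.!
  nCa*a!*[n-a]!≡n! = trans (cong (ℕ._* (a ℕ.! ℕ.* (n ∸ a) ℕ.!)) (ℕC.nCk≡n!/k![n-k]! a≤n))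
    (ℕD.m/n*n≡m {{ℕP._!*_!≢0 a (n ∸ a)}} (ℕC.k![n∸k]!∣n! a≤n))

sumTo-cong : ∀ n {f g : ℕ → ℚ} → (∀ i → i ≤ n → f i ≡ g i) → sumTo n f ≡ sumTo n g
sumTo-cong zero    f≡g = f≡g 0 z≤n
sumTo-cong (suc n) f≡g =
  cong₂ _+ℚ_ (sumTo-cong n (λ i i≤n → f≡g i (ℕP.m≤n⇒m≤1+n i≤n))) (f≡g (suc n) ℕP.≤-refl)

sumTo-cong′ : ∀ n {f g : ℕ → ℚ} → f ≗ g → sumTo n f ≡ sumTo n g
sumTo-cong′ n f≗g = sumTo-cong n (λ i _ → f≗g i)

sumTo-zero : ∀ n (f : ℕ → ℚ) → (∀ i → i ≤ n → f i ≡ 0ℚ) → sumTo n f ≡ 0ℚ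
sumTo-zero zero    f f≡0 = f≡0 0 z≤n
sumTo-zero (suc n) f f≡0 =
  cong₂ _+ℚ_ (sumTo-zero n f (λ i i≤n → f≡0 i (ℕP.m≤n⇒m≤1+n i≤n))) (f≡0 (suc n) ℕP.≤-refl)

sumTo-distrib-+ : ∀ n (f g : ℕ → ℚ) → sumTo n (λ i → f i +ℚ g i) ≡ sumTo n f +ℚ sumTo n g
sumTo-distrib-+ zero    f g = refl
sumTo-distrib-+ (suc n) f g rewrite sumTo-distrib-+ n f g =
  solve 4 (λ a b c d → (a :+ b) :+ (c :+ d) := (a :+ c) :+ (b :+ d)) refl
    (sumTo n f) (sumTo n g) (f (suc n)) (g (suc n))

sumTo-*ˡ : ∀ n c (f : ℕ → ℚ) → c * sumTo n f ≡ sumTo n (λ i → c * f i)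
sumTo-*ˡ zero    c f = refl
sumTo-*ˡ (suc n) c f rewrite sym (sumTo-*ˡ n c f) = ℚP.*-distribˡ-+ c (sumTo n f) (f (suc n))

sumTo-*ʳ : ∀ n c (f : ℕ → ℚ) → sumTo n f * c ≡ sumTo n (λ i → f i * c)
sumTo-*ʳ n c f = trans (ℚP.*-comm (sumTo n f) c)
  (trans (sumTo-*ˡ n c f) (sumTo-cong′ n (λ i → ℚP.*-comm c (f i))))

sumTo-neg : ∀ n (f : ℕ → ℚ) → - sumTo n f ≡ sumTo n (λ i → - f i)
sumTo-neg zero    f = refl
sumTo-neg (suc n) f rewrite sym (sumTo-neg n f) = ℚP.neg-distrib-+ (sumTo n f) (f (suc n))

sumTo-distrib-- : ∀ n (f g : ℕ → ℚ) → sumTo n (λ i → f i -ℚ g i) ≡ sumTo n f -ℚ sumTo n g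
sumTo-distrib-- n f g =
  trans (sumTo-distrib-+ n f (λ i → - g i)) (cong (sumTo n f +ℚ_) (sym (sumTo-neg n g)))

sumTo-unconsˡ : ∀ n (f : ℕ → ℚ) → sumTo (suc n) f ≡ f 0 +ℚ sumTo n (λ i → f (suc i))
sumTo-unconsˡ zero    f = refl
sumTo-unconsˡ (suc n) f rewrite sumTo-unconsˡ n f = ℚP.+-assoc (f 0) _ _

sumTo-extend : ∀ n N (f : ℕ → ℚ) → n ≤ N → (∀ i → n < i → i ≤ N → f i ≡ 0ℚ) → sumTo N f ≡ sumTo n f
sumTo-extend n zero    f z≤n f≡0 = refl
sumTo-extend n (suc N) f n≤N f≡0 with n ℕ.≟ suc N
... | yes refl = refl
... | no  n≢N  = trans
  (cong₂ _+ℚ_ (sumTo-extend n N f (ℕP.≤-pred n<N) (λ i n<i i≤N → f≡0 i n<i (ℕP.m≤n⇒m≤1+n i≤N)))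
              (f≡0 (suc N) n<N ℕP.≤-refl))
  (ℚP.+-identityʳ _)
  where n<N = ℕP.≤∧≢⇒< n≤N n≢N

sumTo-comm : ∀ n m (f : ℕ → ℕ → ℚ) →
  sumTo n (λ i → sumTo m (λ j → f i j)) ≡ sumTo m (λ j → sumTo n (λ i → f i j))
sumTo-comm zero    m f = refl
sumTo-comm (suc n) m f = trans (cong (_+ℚ sumTo m (f (suc n))) (sumTo-comm n m f))
  (sym (sumTo-distrib-+ m (λ j → sumTo n (λ i → f i j)) (f (suc n))))

sumTo-reverse : ∀ n (f : ℕ → ℚ) → sumTo n f ≡ sumTo n (λ i → f (n ∸ i))
sumTo-reverse zero    f = refl
sumTo-reverse (suc n) f = begin
  sumTo (suc n) f
    ≡⟨ sumTo-unconsˡ n f ⟩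
  f 0 +ℚ sumTo n (λ i → f (suc i))
    ≡⟨ cong (f 0 +ℚ_) (sumTo-reverse n (λ i → f (suc i))) ⟩
  f 0 +ℚ sumTo n (λ i → f (suc (n ∸ i)))
    ≡⟨ ℚP.+-comm (f 0) _ ⟩
  sumTo n (λ i → f (suc (n ∸ i))) +ℚ f 0
    ≡⟨ cong₂ _+ℚ_ (sumTo-cong n (λ i i≤n → cong f (sym (ℕP.+-∸-assoc 1 i≤n))))
      (cong f (sym (ℕP.n∸n≡0 n))) ⟩
  sumTo (suc n) (λ i → f (suc n ∸ i)) ∎
  where open ≡-Reasoning

sumTo-lastTerm : ∀ j (f : ℕ → ℚ) → (∀ i → i < j → f i ≡ 0ℚ) → sumTo j f ≡ f j
sumTo-lastTerm zero    f f≡0 = refl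
sumTo-lastTerm (suc j) f f≡0 =
  trans (cong (_+ℚ f (suc j)) (sumTo-zero j f (λ i i≤j → f≡0 i (s≤s i≤j)))) (ℚP.+-identityˡ _)

sumTo-shift : ∀ j m (f : ℕ → ℚ) → (∀ i → i < j → f i ≡ 0ℚ) → sumTo (j + m) f ≡ sumTo m (λ k → f (j + k))
sumTo-shift j zero    f f≡0 rewrite ℕP.+-identityʳ j = sumTo-lastTerm j f f≡0
sumTo-shift j (suc m) f f≡0 rewrite ℕP.+-suc j m = cong (_+ℚ f (suc (j + m))) (sumTo-shift j m f f≡0)

sumTo-from : ∀ m n (G : ℕ → ℚ) → m ≤ n → (∀ j → j < m → G j ≡ 0ℚ) → sumTo (n ∸ m) (λ l → G (l + m)) ≡ sumTo n G
sumTo-from m n G m≤n G≡0 = begin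
  sumTo (n ∸ m) (λ l → G (l + m))   ≡⟨ sumTo-cong′ (n ∸ m) (λ l → cong G (ℕP.+-comm l m)) ⟩
  sumTo (n ∸ m) (λ l → G (m + l))   ≡⟨ sumTo-shift m (n ∸ m) G G≡0 ⟨
  sumTo (m + (n ∸ m)) G             ≡⟨ cong (λ N → sumTo N G) (ℕP.m+[n∸m]≡n m≤n) ⟩
  sumTo n G                         ∎
  where open ≡-Reasoning

sumTo-triangle : ∀ n (F : ℕ → ℕ → ℚ) →
  sumTo n (λ i → sumTo i (λ j → F i j)) ≡ sumTo n (λ j → sumTo (n ∸ j) (λ k → F (j + k) j))
sumTo-triangle n F = begin
  sumTo n (λ i → sumTo i (λ j → F i j))              ≡⟨ sumTo-cong n (λ i i≤n → sym (truncate i i≤n)) ⟩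
  sumTo n (λ i → sumTo n (λ j → [ j ≤ i ] F i j))    ≡⟨ sumTo-comm n n _ ⟩
  sumTo n (λ j → sumTo n (λ i → [ j ≤ i ] F i j))    ≡⟨ sumTo-cong n shift ⟩
  sumTo n (λ j → sumTo (n ∸ j) (λ k → F (j + k) j))  ∎
  where
  open ≡-Reasoning
  [_≤_]_ : ℕ → ℕ → ℚ → ℚ
  [ a ≤ b ] q with a ℕ.≤? b
  ... | yes _ = q
  ... | no  _ = 0ℚ
  [≤]-yes : ∀ {a b} q → a ≤ b → [ a ≤ b ] q ≡ q
  [≤]-yes {a} {b} q a≤b with a ℕ.≤? b
  ... | yes _   = refl
  ... | no  a≰b = ⊥-elim (a≰b a≤b)
  [≤]-no : ∀ {a b} q → b < a → [ a ≤ b ] q ≡ 0ℚ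
  [≤]-no {a} {b} q b<a with a ℕ.≤? b
  ... | yes a≤b = ⊥-elim (ℕP.<⇒≱ b<a a≤b)
  ... | no  _   = refl
  truncate : ∀ i → i ≤ n → sumTo n (λ j → [ j ≤ i ] F i j) ≡ sumTo i (F i)
  truncate i i≤n = trans (sumTo-extend i n _ i≤n (λ j i<j _ → [≤]-no _ i<j))
                         (sumTo-cong i (λ j j≤i → [≤]-yes _ j≤i))
  shift : ∀ j → j ≤ n → sumTo n (λ i → [ j ≤ i ] F i j) ≡ sumTo (n ∸ j) (λ k → F (j + k) j)
  shift j j≤n = begin
    sumTo n (λ i → [ j ≤ i ] F i j)
      ≡⟨ cong (λ N → sumTo N (λ i → [ j ≤ i ] F i j)) (sym (ℕP.m+[n∸m]≡n j≤n)) ⟩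
    sumTo (j + (n ∸ j)) (λ i → [ j ≤ i ] F i j)
      ≡⟨ sumTo-shift j (n ∸ j) _ (λ i i<j → [≤]-no _ i<j) ⟩
    sumTo (n ∸ j) (λ k → [ j ≤ j + k ] F (j + k) j)
      ≡⟨ sumTo-cong′ (n ∸ j) (λ k → [≤]-yes _ (ℕP.m≤m+n j k)) ⟩
    sumTo (n ∸ j) (λ k → F (j + k) j) ∎

-- The ring of formal power series

module ≗-Reasoning = SetoidReasoning (ℕ →-setoid ℚ)
open Setoid (ℕ →-setoid ℚ) using () renaming (refl to ≗-refl; sym to ≗-sym; trans to ≗-trans)

infixr 7 _·_
_·_ : ℚ → FPS → FPS
(c · f) n = c * f n

X : FPS
X zero    = 0ℚ
X (suc n) = one n

·-cong : ∀ c {f g} → f ≗ g → c · f ≗ c · g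
·-cong c f≗g n = cong (c *_) (f≗g n)

·-assoc : ∀ c d f → c · (d · f) ≗ (c * d) · f
·-assoc c d f n = sym (ℚP.*-assoc c d (f n))

·-distribʳ-+ : ∀ c d f → (c · f) ⊕ (d · f) ≗ (c +ℚ d) · f
·-distribʳ-+ c d f n = sym (ℚP.*-distribʳ-+ (f n) c d)

⊕-cong : ∀ {f f′ g g′} → f ≗ f′ → g ≗ g′ → f ⊕ g ≗ f′ ⊕ g′
⊕-cong f≗f′ g≗g′ n = cong₂ _+ℚ_ (f≗f′ n) (g≗g′ n)

⊖-cong : ∀ {f f′ g g′} → f ≗ f′ → g ≗ g′ → f ⊖ g ≗ f′ ⊖ g′
⊖-cong f≗f′ g≗g′ n = cong₂ _-ℚ_ (f≗f′ n) (g≗g′ n)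

⊛-cong : ∀ {f f′ g g′} → f ≗ f′ → g ≗ g′ → f ⊛ g ≗ f′ ⊛ g′
⊛-cong f≗f′ g≗g′ n = sumTo-cong′ n (λ i → cong₂ _*_ (f≗f′ i) (g≗g′ (n ∸ i)))

⊛-congˡ : ∀ f {g g′} → g ≗ g′ → f ⊛ g ≗ f ⊛ g′
⊛-congˡ f = ⊛-cong {f} ≗-refl

⊛-congʳ : ∀ g {f f′} → f ≗ f′ → f ⊛ g ≗ f′ ⊛ g
⊛-congʳ g f≗f′ = ⊛-cong f≗f′ (≗-refl {g})

⊛-comm : ∀ f g → f ⊛ g ≗ g ⊛ f
⊛-comm f g n = trans (sumTo-reverse n _) (sumTo-cong n (λ i i≤n →
  trans (cong (λ j → f (n ∸ i) * g j) (ℕP.m∸[m∸n]≡n i≤n)) (ℚP.*-comm (f (n ∸ i)) (g i))))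

⊛-assoc : ∀ f g h → (f ⊛ g) ⊛ h ≗ f ⊛ (g ⊛ h)
⊛-assoc f g h n = begin
  sumTo n (λ i → sumTo i (λ j → f j * g (i ∸ j)) * h (n ∸ i))
    ≡⟨ sumTo-cong′ n (λ i → sumTo-*ʳ i _ _) ⟩
  sumTo n (λ i → sumTo i (λ j → f j * g (i ∸ j) * h (n ∸ i)))
    ≡⟨ sumTo-triangle n _ ⟩
  sumTo n (λ j → sumTo (n ∸ j) (λ k → f j * g (j + k ∸ j) * h (n ∸ (j + k))))
    ≡⟨ sumTo-cong′ n (λ j → trans
      (sumTo-cong′ (n ∸ j) (λ k → trans (cong₂ (λ a b → f j * g a * h b) (ℕP.m+n∸m≡n j k) (sym (ℕP.∸-+-assoc n j k)))
      (ℚP.*-assoc (f j) (g k) (h (n ∸ j ∸ k)))))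
      (sym (sumTo-*ˡ (n ∸ j) (f j) _))) ⟩
  sumTo n (λ j → f j * sumTo (n ∸ j) (λ k → g k * h (n ∸ j ∸ k))) ∎
  where open ≡-Reasoning

⊛-identityˡ : ∀ f → one ⊛ f ≗ f
⊛-identityˡ f n = trans (sumTo-extend 0 n _ z≤n (λ { (suc i) _ _ → ℚP.*-zeroˡ (f (n ∸ suc i)) }))
                        (ℚP.*-identityˡ (f n))

⊛-identityʳ : ∀ f → f ⊛ one ≗ f
⊛-identityʳ f = ≗-trans (⊛-comm f one) (⊛-identityˡ f)

⊛-distribˡ-⊕ : ∀ f g h → f ⊛ (g ⊕ h) ≗ (f ⊛ g) ⊕ (f ⊛ h)
⊛-distribˡ-⊕ f g h n =
  trans (sumTo-cong′ n (λ i → ℚP.*-distribˡ-+ (f i) (g (n ∸ i)) (h (n ∸ i)))) (sumTo-distrib-+ n _ _)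

⊛-distribʳ-⊕ : ∀ f g h → (g ⊕ h) ⊛ f ≗ (g ⊛ f) ⊕ (h ⊛ f)
⊛-distribʳ-⊕ f g h n =
  trans (sumTo-cong′ n (λ i → ℚP.*-distribʳ-+ (f (n ∸ i)) (g i) (h i))) (sumTo-distrib-+ n _ _)

·-⊛ : ∀ c f g → (c · f) ⊛ g ≗ c · (f ⊛ g)
·-⊛ c f g n = trans (sumTo-cong′ n (λ i → ℚP.*-assoc c (f i) (g (n ∸ i)))) (sym (sumTo-*ˡ n c _))

⊛-· : ∀ c f g → f ⊛ (c · g) ≗ c · (f ⊛ g)
⊛-· c f g = ≗-trans (⊛-comm f (c · g)) (≗-trans (·-⊛ c g f) (·-cong c (⊛-comm g f)))

⊛-leftComm : ∀ f g h → f ⊛ (g ⊛ h) ≗ g ⊛ (f ⊛ h)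
⊛-leftComm f g h = begin
  f ⊛ (g ⊛ h)   ≈⟨ ⊛-assoc f g h ⟨
  (f ⊛ g) ⊛ h   ≈⟨ ⊛-congʳ h (⊛-comm f g) ⟩
  (g ⊛ f) ⊛ h   ≈⟨ ⊛-assoc g f h ⟩
  g ⊛ (f ⊛ h)   ∎
  where open ≗-Reasoning

⊛-middleFour : ∀ f g h k → (f ⊛ g) ⊛ (h ⊛ k) ≗ (f ⊛ h) ⊛ (g ⊛ k)
⊛-middleFour f g h k = begin
  (f ⊛ g) ⊛ (h ⊛ k)   ≈⟨ ⊛-assoc f g (h ⊛ k) ⟩
  f ⊛ (g ⊛ (h ⊛ k))   ≈⟨ ⊛-congˡ f (⊛-leftComm g h k) ⟩
  f ⊛ (h ⊛ (g ⊛ k))   ≈⟨ ⊛-assoc f h (g ⊛ k) ⟨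
  (f ⊛ h) ⊛ (g ⊛ k)   ∎
  where open ≗-Reasoning

X-⊛-zero : ∀ f → (X ⊛ f) 0 ≡ 0ℚ
X-⊛-zero f = ℚP.*-zeroˡ (f 0)

X-⊛-suc : ∀ f n → (X ⊛ f) (suc n) ≡ f n
X-⊛-suc f n = trans (sumTo-unconsˡ n _)
  (trans (cong (_+ℚ (one ⊛ f) n) (ℚP.*-zeroˡ (f (suc n))))
  (trans (ℚP.+-identityˡ _) (⊛-identityˡ f n)))

X-⊛-cancelˡ : ∀ {f g} → X ⊛ f ≗ X ⊛ g → f ≗ g
X-⊛-cancelˡ {f} {g} Xf≗Xg n = trans (sym (X-⊛-suc f n)) (trans (Xf≗Xg (suc n)) (X-⊛-suc g n))

^F-cong : ∀ {f g} m → f ≗ g → f ^F m ≗ g ^F m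
^F-cong zero    f≗g = ≗-refl
^F-cong (suc m) f≗g = ⊛-cong f≗g (^F-cong m f≗g)

^F-+ : ∀ f a b → f ^F (a + b) ≗ (f ^F a) ⊛ (f ^F b)
^F-+ f zero    b = ≗-sym (⊛-identityˡ _)
^F-+ f (suc a) b = ≗-trans (⊛-congˡ f (^F-+ f a b)) (≗-sym (⊛-assoc f (f ^F a) (f ^F b)))

^F-distrib-⊛ : ∀ f g m → (f ⊛ g) ^F m ≗ (f ^F m) ⊛ (g ^F m)
^F-distrib-⊛ f g zero    = ≗-sym (⊛-identityˡ one)
^F-distrib-⊛ f g (suc m) =
  ≗-trans (⊛-congˡ (f ⊛ g) (^F-distrib-⊛ f g m)) (⊛-middleFour f g (f ^F m) (g ^F m))

^F-lowCoeff : ∀ g → g 0 ≡ 0ℚ → ∀ m n → n < m → (g ^F m) n ≡ 0ℚ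
^F-lowCoeff g g₀≡0 (suc m) n (s≤s n≤m) = sumTo-zero n _ λ
  { zero    _     → trans (cong (_* (g ^F m) n) g₀≡0) (ℚP.*-zeroˡ ((g ^F m) n))
  ; (suc i) i<n → trans (cong (g (suc i) *_) (^F-lowCoeff g g₀≡0 m (n ∸ suc i) (ℕP.<-≤-trans (n∸suc-i<n i<n) n≤m)))
                        (ℚP.*-zeroʳ (g (suc i))) }
  where
  n∸suc-i<n : ∀ {n i} → suc i ≤ n → n ∸ suc i < n
  n∸suc-i<n {suc n} {i} _ = s≤s (ℕP.m∸n≤m n i)

-- Composition with a series without constant term

compose-truncate : ∀ F g → g 0 ≡ 0ℚ → ∀ n N → n ≤ N → sumTo N (λ m → F m * (g ^F m) n) ≡ compose F g n
compose-truncate F g g₀≡0 n N n≤N = sumTo-extend n N _ n≤N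
  (λ m n<m _ → trans (cong (F m *_) (^F-lowCoeff g g₀≡0 m n n<m)) (ℚP.*-zeroʳ (F m)))

compose-⊛-coeff : ∀ F g W → g 0 ≡ 0ℚ → ∀ n → (compose F g ⊛ W) n ≡ sumTo n (λ m → F m * ((g ^F m) ⊛ W) n)
compose-⊛-coeff F g W g₀≡0 n = begin
  sumTo n (λ i → compose F g i * W (n ∸ i))
    ≡⟨ sumTo-cong n (λ i i≤n → cong (_* W (n ∸ i))
      (sym (compose-truncate F g g₀≡0 i n i≤n))) ⟩
  sumTo n (λ i → sumTo n (λ m → F m * (g ^F m) i) * W (n ∸ i))
    ≡⟨ sumTo-cong′ n (λ i → sumTo-*ʳ n (W (n ∸ i)) _) ⟩
  sumTo n (λ i → sumTo n (λ m → F m * (g ^F m) i * W (n ∸ i)))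
    ≡⟨ sumTo-comm n n _ ⟩
  sumTo n (λ m → sumTo n (λ i → F m * (g ^F m) i * W (n ∸ i)))
    ≡⟨ sumTo-cong′ n (λ m → trans
      (sumTo-cong′ n (λ i → ℚP.*-assoc (F m) ((g ^F m) i) (W (n ∸ i))))
      (sym (sumTo-*ˡ n (F m) _))) ⟩
  sumTo n (λ m → F m * ((g ^F m) ⊛ W) n) ∎
  where open ≡-Reasoning

compose-homo-⊛ : ∀ F G g → g 0 ≡ 0ℚ → compose (F ⊛ G) g ≗ compose F g ⊛ compose G g
compose-homo-⊛ F G g g₀≡0 n = begin
  sumTo n (λ m → (F ⊛ G) m * (g ^F m) n)
    ≡⟨ sumTo-cong′ n (λ m → sumTo-*ʳ m ((g ^F m) n) _) ⟩
  sumTo n (λ m → sumTo m (λ i → F i * G (m ∸ i) * (g ^F m) n))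
    ≡⟨ sumTo-triangle n _ ⟩
  sumTo n (λ i → sumTo (n ∸ i) (λ k → F i * G (i + k ∸ i) * (g ^F (i + k)) n))
    ≡⟨ sumTo-cong n inner ⟩
  sumTo n (λ i → F i * ((g ^F i) ⊛ compose G g) n)
    ≡⟨ compose-⊛-coeff F g (compose G g) g₀≡0 n ⟨
  (compose F g ⊛ compose G g) n ∎
  where
  open ≡-Reasoning
  inner : ∀ i → i ≤ n → sumTo (n ∸ i) (λ k → F i * G (i + k ∸ i) * (g ^F (i + k)) n) ≡ F i * ((g ^F i) ⊛ compose G g) n
  inner i i≤n = begin
    sumTo (n ∸ i) (λ k → F i * G (i + k ∸ i) * (g ^F (i + k)) n)
      ≡⟨ sumTo-cong′ (n ∸ i) (λ k → trans
        (cong₂ (λ a b → F i * G a * b) (ℕP.m+n∸m≡n i k) (trans (cong (λ j → (g ^F j) n) (ℕP.+-comm i k)) (^F-+ g k i n)))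
        (ℚP.*-assoc (F i) (G k) _)) ⟩
    sumTo (n ∸ i) (λ k → F i * (G k * ((g ^F k) ⊛ (g ^F i)) n))
      ≡⟨ sumTo-*ˡ (n ∸ i) (F i) _ ⟨
    F i * sumTo (n ∸ i) (λ k → G k * ((g ^F k) ⊛ (g ^F i)) n)
      ≡⟨ cong (F i *_) (sumTo-extend (n ∸ i) n _ (ℕP.m∸n≤m n i) high) ⟨
    F i * sumTo n (λ k → G k * ((g ^F k) ⊛ (g ^F i)) n)
      ≡⟨ cong (F i *_) (compose-⊛-coeff G g (g ^F i) g₀≡0 n) ⟨
    F i * (compose G g ⊛ (g ^F i)) n
      ≡⟨ cong (F i *_) (⊛-comm (compose G g) (g ^F i) n) ⟩
    F i * ((g ^F i) ⊛ compose G g) n ∎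
    where
    high : ∀ k → n ∸ i < k → k ≤ n → G k * ((g ^F k) ⊛ (g ^F i)) n ≡ 0ℚ
    high k n∸i<k _ = trans (cong (G k *_) (trans (sym (^F-+ g k i n))
        (^F-lowCoeff g g₀≡0 (k + i) n (subst (_< k + i) (ℕP.m∸n+n≡m i≤n) (ℕP.+-monoˡ-< i n∸i<k)))))
      (ℚP.*-zeroʳ (G k))

compose-cong : ∀ {F F′} g → F ≗ F′ → compose F g ≗ compose F′ g
compose-cong g F≗F′ n = sumTo-cong′ n (λ m → cong (_* (g ^F m) n) (F≗F′ m))

compose-congʳ : ∀ F {g g′} → g ≗ g′ → compose F g ≗ compose F g′
compose-congʳ F g≗g′ n = sumTo-cong′ n (λ m → cong (F m *_) (^F-cong m g≗g′ n))

compose-homo-· : ∀ c F g → compose (c · F) g ≗ c · compose F g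
compose-homo-· c F g n = trans (sumTo-cong′ n (λ m → ℚP.*-assoc c (F m) ((g ^F m) n))) (sym (sumTo-*ˡ n c _))

compose-homo-⊖ : ∀ F G g → compose (F ⊖ G) g ≗ compose F g ⊖ compose G g
compose-homo-⊖ F G g n = trans
  (sumTo-cong′ n (λ m → solve 3 (λ a b c → (a :- b) :* c := a :* c :- b :* c) refl (F m) (G m) ((g ^F m) n)))
  (sumTo-distrib-- n _ _)

compose-constantTerm : ∀ F g → compose F g 0 ≡ F 0
compose-constantTerm F g = ℚP.*-identityʳ (F 0)

compose-one : ∀ g → g 0 ≡ 0ℚ → compose one g ≗ one
compose-one g g₀≡0 n = trans (sym (compose-truncate one g g₀≡0 n n ℕP.≤-refl))
  (trans (sumTo-extend 0 n _ z≤n (λ { (suc m) _ _ → ℚP.*-zeroˡ ((g ^F suc m) n) })) (ℚP.*-identityˡ (one n)))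

compose-X : ∀ g → g 0 ≡ 0ℚ → compose X g ≗ g
compose-X g g₀≡0 zero    = trans (ℚP.*-zeroˡ (one 0)) (sym g₀≡0)
compose-X g g₀≡0 (suc n) = trans
  (sumTo-extend 1 (suc n) _ (s≤s z≤n) (λ { (suc zero) (s≤s ()) _ ; (suc (suc m)) _ _ → ℚP.*-zeroˡ ((g ^F suc (suc m)) (suc n)) }))
  (trans (cong₂ _+ℚ_ (ℚP.*-zeroˡ (one (suc n))) (trans (ℚP.*-identityˡ _) (⊛-identityʳ g (suc n))))
         (ℚP.+-identityˡ (g (suc n))))

compose-homo-^F : ∀ F g → g 0 ≡ 0ℚ → ∀ m → compose (F ^F m) g ≗ compose F g ^F m
compose-homo-^F F g g₀≡0 zero    = compose-one g g₀≡0
compose-homo-^F F g g₀≡0 (suc m) =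
  ≗-trans (compose-homo-⊛ F (F ^F m) g g₀≡0) (⊛-congˡ (compose F g) (compose-homo-^F F g g₀≡0 m))

-- Inverses and integer powers of series with constant term 1

one⊖X-⊛-geom : (one ⊖ X) ⊛ geom ≗ one
one⊖X-⊛-geom zero    = refl
one⊖X-⊛-geom (suc n) = sumTo-extend 1 (suc n) _ (s≤s z≤n) (λ { (suc zero) (s≤s ()) _ ; (suc (suc m)) _ _ → refl })

inv1-inverseˡ : ∀ a → a 0 ≡ 1ℚ → inv1 a ⊛ a ≗ one
inv1-inverseˡ a a₀≡1 = begin
  compose geom u ⊛ a                      ≈⟨ ⊛-congˡ (compose geom u) a≗one⊖X∘u ⟩
  compose geom u ⊛ compose (one ⊖ X) u    ≈⟨ compose-homo-⊛ geom (one ⊖ X) u u₀≡0 ⟨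
  compose (geom ⊛ (one ⊖ X)) u            ≈⟨ compose-cong u (≗-trans (⊛-comm geom (one ⊖ X)) one⊖X-⊛-geom) ⟩
  compose one u                           ≈⟨ compose-one u u₀≡0 ⟩
  one                                     ∎
  where
  open ≗-Reasoning
  u = one ⊖ a
  u₀≡0 : u 0 ≡ 0ℚ
  u₀≡0 = trans (cong (1ℚ -ℚ_) a₀≡1) (ℚP.+-inverseʳ 1ℚ)
  a≗one⊖X∘u : a ≗ compose (one ⊖ X) u
  a≗one⊖X∘u n = sym (trans (compose-homo-⊖ one X u n)
    (trans (cong₂ _-ℚ_ (compose-one u u₀≡0 n) (compose-X u u₀≡0 n))
           (solve 2 (λ x y → x :- (x :- y) := y) refl (one n) (a n))))

inverseˡ-unique : ∀ {a b c} → b ⊛ a ≗ one → c ⊛ a ≗ one → b ≗ c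
inverseˡ-unique {a} {b} {c} ba≗1 ca≗1 = begin
  b                ≈⟨ ⊛-identityʳ b ⟨
  b ⊛ one          ≈⟨ ⊛-congˡ b ca≗1 ⟨
  b ⊛ (c ⊛ a)      ≈⟨ ⊛-leftComm b c a ⟩
  c ⊛ (b ⊛ a)      ≈⟨ ⊛-congˡ c ba≗1 ⟩
  c ⊛ one          ≈⟨ ⊛-identityʳ c ⟩
  c                ∎
  where open ≗-Reasoning

inv1-cong : ∀ {a b} → a ≗ b → inv1 a ≗ inv1 b
inv1-cong a≗b = compose-congʳ geom (⊖-cong (≗-refl {one}) a≗b)

inv1-distrib-⊛ : ∀ a b → a 0 ≡ 1ℚ → b 0 ≡ 1ℚ → inv1 (a ⊛ b) ≗ inv1 a ⊛ inv1 b
inv1-distrib-⊛ a b a₀≡1 b₀≡1 = inverseˡ-unique {a ⊛ b}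
  (inv1-inverseˡ (a ⊛ b) (cong₂ _*_ a₀≡1 b₀≡1))
  (≗-trans (⊛-middleFour (inv1 a) (inv1 b) a b)
           (≗-trans (⊛-cong (inv1-inverseˡ a a₀≡1) (inv1-inverseˡ b b₀≡1)) (⊛-identityˡ one)))

compose-inv1 : ∀ a g → a 0 ≡ 1ℚ → g 0 ≡ 0ℚ → compose (inv1 a) g ≗ inv1 (compose a g)
compose-inv1 a g a₀≡1 g₀≡0 = inverseˡ-unique {compose a g}
  (≗-trans (≗-sym (compose-homo-⊛ (inv1 a) a g g₀≡0))
           (≗-trans (compose-cong g (inv1-inverseˡ a a₀≡1)) (compose-one g g₀≡0)))
  (inv1-inverseˡ (compose a g) (trans (compose-constantTerm a g) a₀≡1))

^ℤF-cong : ∀ {a b} z → a ≗ b → a ^ℤF z ≗ b ^ℤF z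
^ℤF-cong (+ n)    a≗b = ^F-cong n a≗b
^ℤF-cong -[1+ n ] a≗b = ^F-cong (suc n) (inv1-cong a≗b)

^ℤF-distrib-⊛ : ∀ a b z → a 0 ≡ 1ℚ → b 0 ≡ 1ℚ → (a ⊛ b) ^ℤF z ≗ (a ^ℤF z) ⊛ (b ^ℤF z)
^ℤF-distrib-⊛ a b (+ n)    a₀≡1 b₀≡1 = ^F-distrib-⊛ a b n
^ℤF-distrib-⊛ a b -[1+ n ] a₀≡1 b₀≡1 =
  ≗-trans (^F-cong (suc n) (inv1-distrib-⊛ a b a₀≡1 b₀≡1)) (^F-distrib-⊛ (inv1 a) (inv1 b) (suc n))

compose-homo-^ℤF : ∀ a g z → a 0 ≡ 1ℚ → g 0 ≡ 0ℚ → compose (a ^ℤF z) g ≗ compose a g ^ℤF z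
compose-homo-^ℤF a g (+ n)    a₀≡1 g₀≡0 = compose-homo-^F a g g₀≡0 n
compose-homo-^ℤF a g -[1+ n ] a₀≡1 g₀≡0 =
  ≗-trans (compose-homo-^F (inv1 a) g g₀≡0 (suc n)) (^F-cong (suc n) (compose-inv1 a g a₀≡1 g₀≡0))

-- Formal derivative

D : FPS → FPS
D f n = ℕ→ℚ (suc n) * f (suc n)

D-cong : ∀ {f g} → f ≗ g → D f ≗ D g
D-cong f≗g n = cong (ℕ→ℚ (suc n) *_) (f≗g (suc n))

D-· : ∀ c f → D (c · f) ≗ c · D f
D-· c f n = solve 3 (λ a b x → a :* (b :* x) := b :* (a :* x)) refl (ℕ→ℚ (suc n)) c (f (suc n))

D-⊛ : ∀ f g → D (f ⊛ g) ≗ (D f ⊛ g) ⊕ (f ⊛ D g)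
D-⊛ f g n = begin
  ℕ→ℚ (suc n) * sumTo (suc n) (λ i → f i * g (suc n ∸ i))            ≡⟨ sumTo-*ˡ (suc n) (ℕ→ℚ (suc n)) _ ⟩
  sumTo (suc n) (λ i → ℕ→ℚ (suc n) * term i)                         ≡⟨ sumTo-cong (suc n) split ⟩
  sumTo (suc n) (λ i → ℕ→ℚ i * term i +ℚ ℕ→ℚ (suc n ∸ i) * term i)   ≡⟨ sumTo-distrib-+ (suc n) _ _ ⟩
  sumTo (suc n) (λ i → ℕ→ℚ i * term i) +ℚ
    sumTo (suc n) (λ i → ℕ→ℚ (suc n ∸ i) * term i)                   ≡⟨ cong₂ _+ℚ_ D-left D-right ⟩
  (D f ⊛ g) n +ℚ (f ⊛ D g) n                                         ∎
  where
  open ≡-Reasoning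
  term : ℕ → ℚ
  term i = f i * g (suc n ∸ i)
  split : ∀ i → i ≤ suc n → ℕ→ℚ (suc n) * term i ≡ ℕ→ℚ i * term i +ℚ ℕ→ℚ (suc n ∸ i) * term i
  split i i≤1+n = trans (cong (_* term i) (trans (cong ℕ→ℚ (sym (ℕP.m+[n∸m]≡n i≤1+n))) (ℕ→ℚ-homo-+ i (suc n ∸ i))))
                        (ℚP.*-distribʳ-+ (term i) (ℕ→ℚ i) (ℕ→ℚ (suc n ∸ i)))
  D-left : sumTo (suc n) (λ i → ℕ→ℚ i * term i) ≡ (D f ⊛ g) n
  D-left = trans (sumTo-unconsˡ n _)
    (trans (cong₂ _+ℚ_ (ℚP.*-zeroˡ (term 0)) (sumTo-cong′ n (λ i → sym (ℚP.*-assoc (ℕ→ℚ (suc i)) (f (suc i)) (g (n ∸ i))))))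
           (ℚP.+-identityˡ ((D f ⊛ g) n)))
  D-right : sumTo (suc n) (λ i → ℕ→ℚ (suc n ∸ i) * term i) ≡ (f ⊛ D g) n
  D-right = trans
    (cong₂ _+ℚ_ (sumTo-cong n (λ i i≤n → trans (cong (λ j → ℕ→ℚ j * (f i * g j)) (ℕP.+-∸-assoc 1 i≤n))
                   (solve 3 (λ a b c → a :* (b :* c) := b :* (a :* c)) refl (ℕ→ℚ (suc (n ∸ i))) (f i) (g (suc (n ∸ i))))))
                (trans (cong (λ j → ℕ→ℚ j * (f (suc n) * g j)) (ℕP.n∸n≡0 n)) (ℚP.*-zeroˡ (f (suc n) * g 0))))
    (ℚP.+-identityʳ ((f ⊛ D g) n))

D-^F-suc : ∀ g m → D (g ^F suc m) ≗ ℕ→ℚ (suc m) · ((g ^F m) ⊛ D g)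
D-^F-suc g zero = begin
  D (g ⊛ one)              ≈⟨ D-cong (⊛-identityʳ g) ⟩
  D g                      ≈⟨ ⊛-identityˡ (D g) ⟨
  one ⊛ D g                ≈⟨ (λ n → ℚP.*-identityˡ ((one ⊛ D g) n)) ⟨
  1ℚ · (one ⊛ D g)         ∎
  where open ≗-Reasoning
D-^F-suc g (suc m) n = begin
  D (g ⊛ gᵐ⁺¹) n
    ≡⟨ D-⊛ g gᵐ⁺¹ n ⟩
  (D g ⊛ gᵐ⁺¹) n +ℚ (g ⊛ D gᵐ⁺¹) n
    ≡⟨ cong₂ _+ℚ_ (⊛-comm (D g) gᵐ⁺¹ n) (⊛-congˡ g (D-^F-suc g m) n) ⟩
  (gᵐ⁺¹ ⊛ D g) n +ℚ (g ⊛ (ℕ→ℚ (suc m) · (gᵐ ⊛ D g))) n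
    ≡⟨ cong ((gᵐ⁺¹ ⊛ D g) n +ℚ_) (⊛-· (ℕ→ℚ (suc m)) g (gᵐ ⊛ D g) n) ⟩
  (gᵐ⁺¹ ⊛ D g) n +ℚ ℕ→ℚ (suc m) * (g ⊛ (gᵐ ⊛ D g)) n
    ≡⟨ cong (λ y → (gᵐ⁺¹ ⊛ D g) n +ℚ ℕ→ℚ (suc m) * y) (⊛-assoc g gᵐ (D g) n) ⟨
  (gᵐ⁺¹ ⊛ D g) n +ℚ ℕ→ℚ (suc m) * (gᵐ⁺¹ ⊛ D g) n
    ≡⟨ solve 2 (λ y a → y :+ a :* y := (con 1ℚ :+ a) :* y) refl ((gᵐ⁺¹ ⊛ D g) n) (ℕ→ℚ (suc m)) ⟩
  (1ℚ +ℚ ℕ→ℚ (suc m)) * (gᵐ⁺¹ ⊛ D g) n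
    ≡⟨ cong (_* (gᵐ⁺¹ ⊛ D g) n) (ℕ→ℚ-homo-+ 1 (suc m)) ⟨
  ℕ→ℚ (suc (suc m)) * (gᵐ⁺¹ ⊛ D g) n ∎
  where
  open ≡-Reasoning
  gᵐ = g ^F m
  gᵐ⁺¹ = g ^F suc m

D-compose : ∀ F g → g 0 ≡ 0ℚ → D (compose F g) ≗ compose (D F) g ⊛ D g
D-compose F g g₀≡0 n = begin
  ℕ→ℚ (suc n) * sumTo (suc n) (λ m → F m * (g ^F m) (suc n))
    ≡⟨ sumTo-*ˡ (suc n) (ℕ→ℚ (suc n)) _ ⟩
  sumTo (suc n) (λ m → ℕ→ℚ (suc n) * (F m * (g ^F m) (suc n)))
    ≡⟨ sumTo-unconsˡ n _ ⟩
  ℕ→ℚ (suc n) * (F 0 * 0ℚ) +ℚ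
    sumTo n (λ m → ℕ→ℚ (suc n) * (F (suc m) * (g ^F suc m) (suc n)))
      ≡⟨ cong₂ _+ℚ_ constantTerm (sumTo-cong′ n term) ⟩
  0ℚ +ℚ sumTo n (λ m → D F m * ((g ^F m) ⊛ D g) n)
    ≡⟨ ℚP.+-identityˡ _ ⟩
  sumTo n (λ m → D F m * ((g ^F m) ⊛ D g) n)
    ≡⟨ compose-⊛-coeff (D F) g (D g) g₀≡0 n ⟨
  (compose (D F) g ⊛ D g) n ∎
  where
  open ≡-Reasoning
  constantTerm : ℕ→ℚ (suc n) * (F 0 * 0ℚ) ≡ 0ℚ
  constantTerm = trans (cong (ℕ→ℚ (suc n) *_) (ℚP.*-zeroʳ (F 0))) (ℚP.*-zeroʳ (ℕ→ℚ (suc n)))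
  term : ∀ m → ℕ→ℚ (suc n) * (F (suc m) * (g ^F suc m) (suc n)) ≡ D F m * ((g ^F m) ⊛ D g) n
  term m = begin
    ℕ→ℚ (suc n) * (F (suc m) * (g ^F suc m) (suc n))
      ≡⟨ solve 3 (λ a b c → a :* (b :* c) := b :* (a :* c)) refl
        (ℕ→ℚ (suc n)) (F (suc m)) ((g ^F suc m) (suc n)) ⟩
    F (suc m) * D (g ^F suc m) n
      ≡⟨ cong (F (suc m) *_) (D-^F-suc g m n) ⟩
    F (suc m) * (ℕ→ℚ (suc m) * ((g ^F m) ⊛ D g) n)
      ≡⟨ solve 3 (λ f a x → f :* (a :* x) := (a :* f) :* x) refl
        (F (suc m)) (ℕ→ℚ (suc m)) (((g ^F m) ⊛ D g) n) ⟩
    D F m * ((g ^F m) ⊛ D g) n ∎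

-- The binomial series (1 + t)^c

onePlusX : FPS
onePlusX = one ⊕ X

onePlusX-⊛-zero : ∀ w → (onePlusX ⊛ w) 0 ≡ w 0
onePlusX-⊛-zero w = trans (⊛-distribʳ-⊕ w one X 0)
  (trans (cong₂ _+ℚ_ (⊛-identityˡ w 0) (X-⊛-zero w)) (ℚP.+-identityʳ (w 0)))

onePlusX-⊛-suc : ∀ w n → (onePlusX ⊛ w) (suc n) ≡ w (suc n) +ℚ w n
onePlusX-⊛-suc w n = trans (⊛-distribʳ-⊕ w one X (suc n)) (cong₂ _+ℚ_ (⊛-identityˡ w (suc n)) (X-⊛-suc w n))

BinomialRecurrence : ℚ → FPS → Set
BinomialRecurrence c f = ∀ n → ℕ→ℚ (suc n) * f (suc n) ≡ (c -ℚ ℕ→ℚ n) * f n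

BinomialODE : ℚ → FPS → Set
BinomialODE c f = onePlusX ⊛ D f ≗ c · f

binomialODE⇒recurrence : ∀ c f → BinomialODE c f → BinomialRecurrence c f
binomialODE⇒recurrence c f ode zero =
  trans (sym (onePlusX-⊛-zero (D f))) (trans (ode 0) (cong (_* f 0) (sym (ℚP.+-identityʳ c))))
binomialODE⇒recurrence c f ode (suc m) = begin
  y′                    ≡⟨ solve 3 (λ y′ a y → y′ := (y′ :+ a :* y) :- a :* y) refl y′ a y ⟩
  (y′ +ℚ a * y) -ℚ a * y ≡⟨ cong (_-ℚ a * y) (trans (sym (onePlusX-⊛-suc (D f) m)) (ode (suc m))) ⟩
  c * y -ℚ a * y        ≡⟨ solve 3 (λ c a y → c :* y :- a :* y := (c :- a) :* y) refl c a y ⟩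
  (c -ℚ a) * y          ∎
  where
  open ≡-Reasoning
  y′ = ℕ→ℚ (suc (suc m)) * f (suc (suc m))
  a  = ℕ→ℚ (suc m)
  y  = f (suc m)

recurrence⇒binomialODE : ∀ c f → BinomialRecurrence c f → BinomialODE c f
recurrence⇒binomialODE c f rec zero =
  trans (onePlusX-⊛-zero (D f)) (trans (rec 0) (cong (_* f 0) (ℚP.+-identityʳ c)))
recurrence⇒binomialODE c f rec (suc m) = trans (onePlusX-⊛-suc (D f) m)
  (trans (cong (_+ℚ ℕ→ℚ (suc m) * f (suc m)) (rec (suc m)))
         (solve 3 (λ c a y → (c :- a) :* y :+ a :* y := c :* y) refl c (ℕ→ℚ (suc m)) (f (suc m))))

binomialRecurrence-unique : ∀ c f h → BinomialRecurrence c f → BinomialRecurrence c h → f 0 ≡ h 0 → f ≗ h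
binomialRecurrence-unique c f h recf rech f₀≡h₀ zero    = f₀≡h₀
binomialRecurrence-unique c f h recf rech f₀≡h₀ (suc n) = ℕ→ℚ-suc-*-cancelˡ n
  (trans (recf n) (trans (cong ((c -ℚ ℕ→ℚ n) *_) (binomialRecurrence-unique c f h recf rech f₀≡h₀ n)) (sym (rech n))))

onePlusTPow-recurrence : ∀ c → BinomialRecurrence c (onePlusTPow c)
onePlusTPow-recurrence c n = begin
  ℕ→ℚ (suc n) * (fallingℚ c n * (c -ℚ ℕ→ℚ n) * invℕ (suc n ℕ.!))
    ≡⟨ solve 4 (λ a F x b → a :* (F :* x :* b) := F :* x :* (a :* b)) refl
      (ℕ→ℚ (suc n)) (fallingℚ c n) (c -ℚ ℕ→ℚ n) (invℕ (suc n ℕ.!)) ⟩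
  fallingℚ c n * (c -ℚ ℕ→ℚ n) * (ℕ→ℚ (suc n) * invℕ (suc n ℕ.!))
    ≡⟨ cong (fallingℚ c n * (c -ℚ ℕ→ℚ n) *_) (ℕ→ℚ-suc-*-invℕ-suc-! n) ⟩
  fallingℚ c n * (c -ℚ ℕ→ℚ n) * invℕ (n ℕ.!)
    ≡⟨ solve 3 (λ F x b → F :* x :* b := x :* (F :* b)) refl
      (fallingℚ c n) (c -ℚ ℕ→ℚ n) (invℕ (n ℕ.!)) ⟩
  (c -ℚ ℕ→ℚ n) * onePlusTPow c n ∎
  where open ≡-Reasoning

onePlusTPow-zero : onePlusTPow 0ℚ ≗ one
onePlusTPow-zero = binomialRecurrence-unique 0ℚ (onePlusTPow 0ℚ) one (onePlusTPow-recurrence 0ℚ) one-recurrence refl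
  where
  one-recurrence : BinomialRecurrence 0ℚ one
  one-recurrence zero    = refl
  one-recurrence (suc n) = trans (ℚP.*-zeroʳ (ℕ→ℚ (suc (suc n)))) (sym (ℚP.*-zeroʳ (0ℚ -ℚ ℕ→ℚ (suc n))))

onePlusTPow-cong : ∀ {a b} → a ≡ b → onePlusTPow a ≗ onePlusTPow b
onePlusTPow-cong a≡b n = cong (λ c → onePlusTPow c n) a≡b

onePlusTPow-+ : ∀ a b → onePlusTPow a ⊛ onePlusTPow b ≗ onePlusTPow (a +ℚ b)
onePlusTPow-+ a b = binomialRecurrence-unique (a +ℚ b) (A ⊛ B) (onePlusTPow (a +ℚ b))
  (binomialODE⇒recurrence (a +ℚ b) (A ⊛ B) ode) (onePlusTPow-recurrence (a +ℚ b)) refl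
  where
  open ≗-Reasoning
  A = onePlusTPow a
  B = onePlusTPow b
  odeA : BinomialODE a A
  odeA = recurrence⇒binomialODE a A (onePlusTPow-recurrence a)
  odeB : BinomialODE b B
  odeB = recurrence⇒binomialODE b B (onePlusTPow-recurrence b)
  ode : BinomialODE (a +ℚ b) (A ⊛ B)
  ode = begin
    onePlusX ⊛ D (A ⊛ B)
      ≈⟨ ⊛-congˡ onePlusX (D-⊛ A B) ⟩
    onePlusX ⊛ ((D A ⊛ B) ⊕ (A ⊛ D B))
      ≈⟨ ⊛-distribˡ-⊕ onePlusX (D A ⊛ B) (A ⊛ D B) ⟩
    (onePlusX ⊛ (D A ⊛ B)) ⊕ (onePlusX ⊛ (A ⊛ D B))
      ≈⟨ ⊕-cong (≗-sym (⊛-assoc onePlusX (D A) B)) (⊛-leftComm onePlusX A (D B)) ⟩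
    ((onePlusX ⊛ D A) ⊛ B) ⊕ (A ⊛ (onePlusX ⊛ D B))
      ≈⟨ ⊕-cong (≗-trans (⊛-congʳ B odeA) (·-⊛ a A B))
        (≗-trans (⊛-congˡ A odeB) (⊛-· b A B)) ⟩
    (a · (A ⊛ B)) ⊕ (b · (A ⊛ B))
      ≈⟨ ·-distribʳ-+ a b (A ⊛ B) ⟩
    (a +ℚ b) · (A ⊛ B) ∎

onePlusTPow-^F : ∀ c m → onePlusTPow c ^F m ≗ onePlusTPow (ℕ→ℚ m * c)
onePlusTPow-^F c zero    = ≗-trans (≗-sym onePlusTPow-zero) (onePlusTPow-cong (sym (ℚP.*-zeroˡ c)))
onePlusTPow-^F c (suc m) = ≗-trans (⊛-congˡ (onePlusTPow c) (onePlusTPow-^F c m))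
  (≗-trans (onePlusTPow-+ c (ℕ→ℚ m * c)) (onePlusTPow-cong (begin
    c +ℚ ℕ→ℚ m * c          ≡⟨ solve 2 (λ c a → c :+ a :* c := (con 1ℚ :+ a) :* c) refl c (ℕ→ℚ m) ⟩
    (1ℚ +ℚ ℕ→ℚ m) * c       ≡⟨ cong (_* c) (ℕ→ℚ-homo-+ 1 m) ⟨
    ℕ→ℚ (suc m) * c         ∎)))
  where open ≡-Reasoning

inv1-onePlusTPow : ∀ c → inv1 (onePlusTPow c) ≗ onePlusTPow (- c)
inv1-onePlusTPow c = inverseˡ-unique {onePlusTPow c} (inv1-inverseˡ (onePlusTPow c) refl)
  (≗-trans (onePlusTPow-+ (- c) c) (≗-trans (onePlusTPow-cong (ℚP.+-inverseˡ c)) onePlusTPow-zero))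

onePlusTPow-^ℤF : ∀ c z → onePlusTPow c ^ℤF z ≗ onePlusTPow (ℤ→ℚ z * c)
onePlusTPow-^ℤF c (+ n)    = onePlusTPow-^F c n
onePlusTPow-^ℤF c -[1+ n ] = ≗-trans (^F-cong (suc n) (inv1-onePlusTPow c))
  (≗-trans (onePlusTPow-^F (- c) (suc n))
           (onePlusTPow-cong (solve 2 (λ a c → a :* (:- c) := (:- a) :* c) refl (ℕ→ℚ (suc n)) c)))

-- Exponential and logarithm

D-expX : ∀ c → D (expX c) ≗ c · expX c
D-expX c n = begin
  ℕ→ℚ (suc n) * (c * c ^ℚ n * invℕ (suc n ℕ.!))
    ≡⟨ solve 4 (λ a c p b → a :* (c :* p :* b) := c :* p :* (a :* b)) refl
      (ℕ→ℚ (suc n)) c (c ^ℚ n) (invℕ (suc n ℕ.!)) ⟩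
  c * c ^ℚ n * (ℕ→ℚ (suc n) * invℕ (suc n ℕ.!))
    ≡⟨ cong (c * c ^ℚ n *_) (ℕ→ℚ-suc-*-invℕ-suc-! n) ⟩
  c * c ^ℚ n * invℕ (n ℕ.!)
    ≡⟨ ℚP.*-assoc c (c ^ℚ n) (invℕ (n ℕ.!)) ⟩
  c * expX c n ∎
  where open ≡-Reasoning

-- E = exp(c g) solves (1 + t) E′ = c (1 + t) g′ E = c d E, which characterises (1 + t)^{c d}.
compose-expX : ∀ c d g → g 0 ≡ 0ℚ → onePlusX ⊛ D g ≗ d · one → compose (expX c) g ≗ onePlusTPow (c * d)
compose-expX c d g g₀≡0 g-ode = binomialRecurrence-unique (c * d) E (onePlusTPow (c * d))
  (binomialODE⇒recurrence (c * d) E ode) (onePlusTPow-recurrence (c * d)) (compose-constantTerm (expX c) g)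
  where
  open ≗-Reasoning
  E = compose (expX c) g
  ode : BinomialODE (c * d) E
  ode = begin
    onePlusX ⊛ D E
      ≈⟨ ⊛-congˡ onePlusX (D-compose (expX c) g g₀≡0) ⟩
    onePlusX ⊛ (compose (D (expX c)) g ⊛ D g)
      ≈⟨ ⊛-congˡ onePlusX (⊛-congʳ (D g)
        (≗-trans (compose-cong g (D-expX c)) (compose-homo-· c (expX c) g))) ⟩
    onePlusX ⊛ ((c · E) ⊛ D g)
      ≈⟨ ⊛-congˡ onePlusX (·-⊛ c E (D g)) ⟩
    onePlusX ⊛ (c · (E ⊛ D g))
      ≈⟨ ⊛-· c onePlusX (E ⊛ D g) ⟩
    c · (onePlusX ⊛ (E ⊛ D g))
      ≈⟨ ·-cong c (⊛-leftComm onePlusX E (D g)) ⟩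
    c · (E ⊛ (onePlusX ⊛ D g))
      ≈⟨ ·-cong c (⊛-congˡ E g-ode) ⟩
    c · (E ⊛ (d · one))
      ≈⟨ ·-cong c (≗-trans (⊛-· d E one) (·-cong d (⊛-identityʳ E))) ⟩
    c · (d · E)
      ≈⟨ ·-assoc c d E ⟩
    (c * d) · E ∎

D-log1p : D log1p ≗ negOnePow
D-log1p n = begin
  ℕ→ℚ (suc n) * (negOnePow n * invℕ (suc n))   ≡⟨ solve 3 (λ a s b → a :* (s :* b) := s :* (a :* b)) refl
                                                     (ℕ→ℚ (suc n)) (negOnePow n) (invℕ (suc n)) ⟩
  negOnePow n * (ℕ→ℚ (suc n) * invℕ (suc n))   ≡⟨ cong (negOnePow n *_) (ℕ→ℚ-*-invℕ (suc n)) ⟩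
  negOnePow n * 1ℚ                             ≡⟨ ℚP.*-identityʳ (negOnePow n) ⟩
  negOnePow n                                  ∎
  where open ≡-Reasoning

log1p-ode : onePlusX ⊛ D log1p ≗ 1ℚ · one
log1p-ode zero    = trans (onePlusX-⊛-zero (D log1p)) (D-log1p 0)
log1p-ode (suc n) = trans (onePlusX-⊛-suc (D log1p) n)
  (trans (cong₂ _+ℚ_ (D-log1p (suc n)) (D-log1p n)) (ℚP.+-inverseˡ (negOnePow n)))

negLog1p : FPS
negLog1p = (- 1ℚ) · log1p

negLog1p-ode : onePlusX ⊛ D negLog1p ≗ (- 1ℚ * 1ℚ) · one
negLog1p-ode = begin
  onePlusX ⊛ D negLog1p            ≈⟨ ⊛-congˡ onePlusX (D-· (- 1ℚ) log1p) ⟩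
  onePlusX ⊛ ((- 1ℚ) · D log1p)    ≈⟨ ⊛-· (- 1ℚ) onePlusX (D log1p) ⟩
  (- 1ℚ) · (onePlusX ⊛ D log1p)    ≈⟨ ·-cong (- 1ℚ) log1p-ode ⟩
  (- 1ℚ) · (1ℚ · one)              ≈⟨ ·-assoc (- 1ℚ) 1ℚ one ⟩
  (- 1ℚ * 1ℚ) · one                ∎
  where open ≗-Reasoning

expX-∘-negLog1p : ∀ x → compose (expX x) negLog1p ≗ onePlusTPow (- x)
expX-∘-negLog1p x = ≗-trans (compose-expX x (- 1ℚ * 1ℚ) negLog1p refl negLog1p-ode)
  (onePlusTPow-cong (solve 1 (λ x → x :* (:- con 1ℚ :* con 1ℚ) := :- x) refl x))

negLog1p-^F : ∀ m → negLog1p ^F m ≗ negOnePow m · (log1p ^F m)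
negLog1p-^F zero    n = sym (ℚP.*-identityˡ (one n))
negLog1p-^F (suc m) = begin
  negLog1p ⊛ (negLog1p ^F m)
    ≈⟨ ⊛-congˡ negLog1p (negLog1p-^F m) ⟩
  negLog1p ⊛ (negOnePow m · (log1p ^F m))
    ≈⟨ ⊛-· (negOnePow m) negLog1p (log1p ^F m) ⟩
  negOnePow m · (negLog1p ⊛ (log1p ^F m))
    ≈⟨ ·-cong (negOnePow m) (·-⊛ (- 1ℚ) log1p (log1p ^F m)) ⟩
  negOnePow m · ((- 1ℚ) · (log1p ^F suc m))
    ≈⟨ ·-assoc (negOnePow m) (- 1ℚ) (log1p ^F suc m) ⟩
  (negOnePow m * - 1ℚ) · (log1p ^F suc m)
    ≈⟨ (λ n → cong (_* (log1p ^F suc m) n)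
      (solve 1 (λ s → s :* (:- con 1ℚ) := :- s) refl (negOnePow m))) ⟩
  negOnePow (suc m) · (log1p ^F suc m) ∎
  where open ≗-Reasoning

-- (e^{-L} - 1)/(-L) · L/t = 1/(1 + t) for L = log(1 + t)

X-⊛-expm1OverT : X ⊛ expm1OverT ≗ expX 1ℚ ⊖ one
X-⊛-expm1OverT zero    = refl
X-⊛-expm1OverT (suc n) = trans (X-⊛-suc expm1OverT n) (sym (begin
  1ℚ ^ℚ suc n * invℕ (suc n ℕ.!) -ℚ 0ℚ   ≡⟨ ℚP.+-identityʳ _ ⟩
  1ℚ ^ℚ suc n * invℕ (suc n ℕ.!)         ≡⟨ cong (_* invℕ (suc n ℕ.!)) (1^ℚn≡1 (suc n)) ⟩
  1ℚ * invℕ (suc n ℕ.!)                  ≡⟨ ℚP.*-identityˡ _ ⟩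
  invℕ (suc n ℕ.!)                       ∎))
  where
  open ≡-Reasoning
  1^ℚn≡1 : ∀ n → 1ℚ ^ℚ n ≡ 1ℚ
  1^ℚn≡1 zero    = refl
  1^ℚn≡1 (suc n) = trans (ℚP.*-identityˡ (1ℚ ^ℚ n)) (1^ℚn≡1 n)

log1p≗X⊛logOverT : log1p ≗ X ⊛ logOverT
log1p≗X⊛logOverT zero    = sym (X-⊛-zero logOverT)
log1p≗X⊛logOverT (suc n) = sym (X-⊛-suc logOverT n)

onePlusTPow-1 : onePlusTPow 1ℚ ≗ onePlusX
onePlusTPow-1 zero          = refl
onePlusTPow-1 (suc zero)    = refl
onePlusTPow-1 (suc (suc n)) = trans (cong (_* invℕ (suc (suc n) ℕ.!)) (falling-1 n)) (ℚP.*-zeroˡ (invℕ (suc (suc n) ℕ.!)))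
  where
  falling-1 : ∀ n → fallingℚ 1ℚ (suc (suc n)) ≡ 0ℚ
  falling-1 zero    = refl
  falling-1 (suc n) = trans (cong (_* (1ℚ -ℚ ℕ→ℚ (suc (suc n)))) (falling-1 n)) (ℚP.*-zeroˡ (1ℚ -ℚ ℕ→ℚ (suc (suc n))))

X-⊛-onePlusTPow-neg1 : X ⊛ onePlusTPow (- 1ℚ) ≗ one ⊖ onePlusTPow (- 1ℚ)
X-⊛-onePlusTPow-neg1 n = begin
  y
    ≡⟨ solve 2 (λ q y → y := (q :+ y) :- q) refl q y ⟩
  (q +ℚ y) -ℚ q
    ≡⟨ cong (_-ℚ q) (trans (cong₂ _+ℚ_ (sym (⊛-identityˡ Q n)) refl) (sym (⊛-distribʳ-⊕ Q one X n))) ⟩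
  (onePlusX ⊛ Q) n -ℚ q
    ≡⟨ cong (_-ℚ q) onePlusX⊛Q≡one ⟩
  one n -ℚ q ∎
  where
  open ≡-Reasoning
  Q = onePlusTPow (- 1ℚ)
  q = Q n
  y = (X ⊛ Q) n
  onePlusX⊛Q≡one : (onePlusX ⊛ Q) n ≡ one n
  onePlusX⊛Q≡one = trans (⊛-congʳ Q (≗-sym onePlusTPow-1) n)
    (trans (onePlusTPow-+ 1ℚ (- 1ℚ) n) (trans (onePlusTPow-cong (ℚP.+-inverseʳ 1ℚ) n) (onePlusTPow-zero n)))

negLog1p-⊛-expm1OverT∘negLog1p : negLog1p ⊛ compose expm1OverT negLog1p ≗ onePlusTPow (- 1ℚ) ⊖ one
negLog1p-⊛-expm1OverT∘negLog1p = begin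
  negLog1p ⊛ compose expm1OverT negLog1p
    ≈⟨ ⊛-congʳ (compose expm1OverT negLog1p) (compose-X negLog1p refl) ⟨
  compose X negLog1p ⊛ compose expm1OverT negLog1p
    ≈⟨ compose-homo-⊛ X expm1OverT negLog1p refl ⟨
  compose (X ⊛ expm1OverT) negLog1p
    ≈⟨ compose-cong negLog1p X-⊛-expm1OverT ⟩
  compose (expX 1ℚ ⊖ one) negLog1p
    ≈⟨ compose-homo-⊖ (expX 1ℚ) one negLog1p ⟩
  compose (expX 1ℚ) negLog1p ⊖ compose one negLog1p
    ≈⟨ ⊖-cong (expX-∘-negLog1p 1ℚ) (compose-one negLog1p refl) ⟩
  onePlusTPow (- 1ℚ) ⊖ one ∎
  where open ≗-Reasoning

expm1OverT∘negLog1p-⊛-log1p : compose expm1OverT negLog1p ⊛ log1p ≗ one ⊖ onePlusTPow (- 1ℚ)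
expm1OverT∘negLog1p-⊛-log1p n = begin
  (A ⊛ log1p) n
    ≡⟨ ⊛-comm A log1p n ⟩
  y
    ≡⟨ solve 1 (λ y → y := :- (:- con 1ℚ :* y)) refl y ⟩
  - (- 1ℚ * y)
    ≡⟨ cong -_ (trans (sym (·-⊛ (- 1ℚ) log1p A n)) (negLog1p-⊛-expm1OverT∘negLog1p n)) ⟩
  - (onePlusTPow (- 1ℚ) n -ℚ one n)
    ≡⟨ solve 2 (λ q o → :- (q :- o) := o :- q) refl (onePlusTPow (- 1ℚ) n) (one n) ⟩
  one n -ℚ onePlusTPow (- 1ℚ) n ∎
  where
  open ≡-Reasoning
  A = compose expm1OverT negLog1p
  y = (log1p ⊛ A) n

expm1OverT∘negLog1p-⊛-logOverT : compose expm1OverT negLog1p ⊛ logOverT ≗ onePlusTPow (- 1ℚ)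
expm1OverT∘negLog1p-⊛-logOverT = X-⊛-cancelˡ (begin
  X ⊛ (A ⊛ logOverT)             ≈⟨ ⊛-leftComm X A logOverT ⟩
  A ⊛ (X ⊛ logOverT)             ≈⟨ ⊛-congˡ A log1p≗X⊛logOverT ⟨
  A ⊛ log1p                      ≈⟨ expm1OverT∘negLog1p-⊛-log1p ⟩
  one ⊖ onePlusTPow (- 1ℚ)       ≈⟨ X-⊛-onePlusTPow-neg1 ⟨
  X ⊛ onePlusTPow (- 1ℚ)         ∎)
  where
  open ≗-Reasoning
  A = compose expm1OverT negLog1p

-- n! times the n-th coefficients of these series are BernoulliPoly r n x, CarlitzBeta r n x and CauchyPoly k n x.

bernoulliGF : ℤ → ℚ → FPS
bernoulliGF r x = (expm1OverT ^ℤF (ℤ.- r)) ⊛ expX x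

carlitzGF : ℤ → ℚ → FPS
carlitzGF r x = (logOverT ^ℤF (ℤ.- r)) ⊛ onePlusTPow x

cauchyGF : ℤ → ℚ → FPS
cauchyGF k x = compose (Lif k) log1p ⊛ onePlusTPow (- x)

compose-bernoulliFactor-⊛-carlitzGF : ∀ r →
  compose (expm1OverT ^ℤF (ℤ.- r)) negLog1p ⊛ carlitzGF r (- ℤ→ℚ r) ≗ one
compose-bernoulliFactor-⊛-carlitzGF r = begin
  compose (expm1OverT ^ℤF q) negLog1p ⊛ ((logOverT ^ℤF q) ⊛ O)
    ≈⟨ ⊛-congʳ ((logOverT ^ℤF q) ⊛ O) (compose-homo-^ℤF expm1OverT negLog1p q refl refl) ⟩
  (A ^ℤF q) ⊛ ((logOverT ^ℤF q) ⊛ O)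
    ≈⟨ ⊛-assoc (A ^ℤF q) (logOverT ^ℤF q) O ⟨
  ((A ^ℤF q) ⊛ (logOverT ^ℤF q)) ⊛ O
    ≈⟨ ⊛-congʳ O (^ℤF-distrib-⊛ A logOverT q refl refl) ⟨
  ((A ⊛ logOverT) ^ℤF q) ⊛ O
    ≈⟨ ⊛-congʳ O (^ℤF-cong q expm1OverT∘negLog1p-⊛-logOverT) ⟩
  (onePlusTPow (- 1ℚ) ^ℤF q) ⊛ O
    ≈⟨ ⊛-congʳ O (onePlusTPow-^ℤF (- 1ℚ) q) ⟩
  onePlusTPow (ℤ→ℚ q * - 1ℚ) ⊛ O
    ≈⟨ onePlusTPow-+ (ℤ→ℚ q * - 1ℚ) (- ℤ→ℚ r) ⟩
  onePlusTPow (ℤ→ℚ q * - 1ℚ +ℚ - ℤ→ℚ r)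
    ≈⟨ onePlusTPow-cong exponent≡0 ⟩
  onePlusTPow 0ℚ
    ≈⟨ onePlusTPow-zero ⟩
  one ∎
  where
  open ≗-Reasoning
  q = ℤ.- r
  O = onePlusTPow (- ℤ→ℚ r)
  A = compose expm1OverT negLog1p
  exponent≡0 : ℤ→ℚ q * - 1ℚ +ℚ - ℤ→ℚ r ≡ 0ℚ
  exponent≡0 = trans (cong (λ c → c * - 1ℚ +ℚ - ℤ→ℚ r) (ℤ→ℚ-neg r))
    (solve 1 (λ a → (:- a) :* (:- con 1ℚ) :+ (:- a) := con 0ℚ) refl (ℤ→ℚ r))

cauchyGF-factorisation : ∀ k r x →
  cauchyGF k x ≗ compose (bernoulliGF r x) negLog1p ⊛ (carlitzGF r (- ℤ→ℚ r) ⊛ cauchyGF k 0ℚ)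
cauchyGF-factorisation k r x = ≗-sym (begin
  compose (bernoulliGF r x) negLog1p ⊛ (β ⊛ cauchyGF k 0ℚ)
    ≈⟨ ⊛-cong compose-bernoulliGF (⊛-congˡ β cauchyGF-0) ⟩
  (E ⊛ O) ⊛ (β ⊛ L)
    ≈⟨ ⊛-middleFour E O β L ⟩
  (E ⊛ β) ⊛ (O ⊛ L)
    ≈⟨ ⊛-congʳ (O ⊛ L) (compose-bernoulliFactor-⊛-carlitzGF r) ⟩
  one ⊛ (O ⊛ L)
    ≈⟨ ⊛-identityˡ (O ⊛ L) ⟩
  O ⊛ L
    ≈⟨ ⊛-comm O L ⟩
  cauchyGF k x ∎)
  where
  open ≗-Reasoning
  E = compose (expm1OverT ^ℤF (ℤ.- r)) negLog1p
  O = onePlusTPow (- x)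
  β = carlitzGF r (- ℤ→ℚ r)
  L = compose (Lif k) log1p
  compose-bernoulliGF : compose (bernoulliGF r x) negLog1p ≗ E ⊛ O
  compose-bernoulliGF = ≗-trans (compose-homo-⊛ (expm1OverT ^ℤF (ℤ.- r)) (expX x) negLog1p refl)
                                (⊛-congˡ E (expX-∘-negLog1p x))
  cauchyGF-0 : cauchyGF k 0ℚ ≗ L
  cauchyGF-0 = ≗-trans (⊛-congˡ L onePlusTPow-zero) (⊛-identityʳ L)

fact-*-⊛ : ∀ f g n → fact n * (f ⊛ g) n ≡ sumTo n (λ j → ℕ→ℚ (n C j) * (fact j * f j) * (fact (n ∸ j) * g (n ∸ j)))
fact-*-⊛ f g n = trans (sumTo-*ˡ n (fact n) _) (sumTo-cong n term)
  where
  term : ∀ j → j ≤ n → fact n * (f j * g (n ∸ j)) ≡ ℕ→ℚ (n C j) * (fact j * f j) * (fact (n ∸ j) * g (n ∸ j))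
  term j j≤n = begin
    fact n * (f j * g (n ∸ j))
      ≡⟨ cong (_* (f j * g (n ∸ j))) (C-*-!-*-! n j j≤n) ⟨
    ℕ→ℚ (n C j) * fact j * fact (n ∸ j) * (f j * g (n ∸ j))
      ≡⟨ solve 5 (λ c a b u v → c :* a :* b :* (u :* v) := c :* (a :* u) :* (b :* v))
        refl (ℕ→ℚ (n C j)) (fact j) (fact (n ∸ j)) (f j) (g (n ∸ j)) ⟩
    ℕ→ℚ (n C j) * (fact j * f j) * (fact (n ∸ j) * g (n ∸ j)) ∎
    where open ≡-Reasoning

fact-*-S₁ : ∀ l m → fact m * S₁ l m ≡ fact l * (log1p ^F m) l
fact-*-S₁ l m = begin
  fact m * (fact l * invℕ (m ℕ.!) * y)
    ≡⟨ solve 4 (λ a b c y → a :* (b :* c :* y) := b :* y :* (a :* c)) refl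
      (fact m) (fact l) (invℕ (m ℕ.!)) y ⟩
  fact l * y * (fact m * invℕ (m ℕ.!))
    ≡⟨ cong (fact l * y *_) (fact-*-invℕ-! m) ⟩
  fact l * y * 1ℚ
    ≡⟨ ℚP.*-identityʳ (fact l * y) ⟩
  fact l * y ∎
  where
  open ≡-Reasoning
  y = (log1p ^F m) l

fact-*-log1p^F-⊛ : ∀ n m W → m ≤ n →
  fact m * sumTo (n ∸ m) (λ l → ℕ→ℚ (n C (l + m)) * S₁ (l + m) m * (fact (n ∸ m ∸ l) * W (n ∸ m ∸ l)))
    ≡ fact n * ((log1p ^F m) ⊛ W) n
fact-*-log1p^F-⊛ n m W m≤n = begin
  fact m * sumTo (n ∸ m) (λ l → c l * (fact (N l) * W (N l)))
    ≡⟨ sumTo-*ˡ (n ∸ m) (fact m) _ ⟩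
  sumTo (n ∸ m) (λ l → fact m * (c l * (fact (N l) * W (N l))))
    ≡⟨ sumTo-cong′ (n ∸ m) term ⟩
  sumTo (n ∸ m) (λ l → G (l + m))
    ≡⟨ sumTo-from m n G m≤n low ⟩
  sumTo n G
    ≡⟨ fact-*-⊛ (log1p ^F m) W n ⟨
  fact n * ((log1p ^F m) ⊛ W) n ∎
  where
  open ≡-Reasoning
  N : ℕ → ℕ
  N l = n ∸ m ∸ l
  c : ℕ → ℚ
  c l = ℕ→ℚ (n C (l + m)) * S₁ (l + m) m
  G : ℕ → ℚ
  G j = ℕ→ℚ (n C j) * (fact j * (log1p ^F m) j) * (fact (n ∸ j) * W (n ∸ j))
  term : ∀ l → fact m * (c l * (fact (N l) * W (N l))) ≡ G (l + m)
  term l = begin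
    fact m * (c l * (fact (N l) * W (N l)))
      ≡⟨ solve 4 (λ f b s w → f :* (b :* s :* w) := b :* (f :* s) :* w) refl
        (fact m) (ℕ→ℚ (n C (l + m))) (S₁ (l + m) m) (fact (N l) * W (N l)) ⟩
    ℕ→ℚ (n C (l + m)) * (fact m * S₁ (l + m) m) * (fact (N l) * W (N l))
      ≡⟨ cong₂ (λ s j → ℕ→ℚ (n C (l + m)) * s * (fact j * W j))
        (fact-*-S₁ (l + m) m) (trans (ℕP.∸-+-assoc n m l) (cong (n ∸_) (ℕP.+-comm m l))) ⟩
    G (l + m) ∎
  low : ∀ j → j < m → G j ≡ 0ℚ
  low j j<m = trans (cong (λ y → ℕ→ℚ (n C j) * (fact j * y) * (fact (n ∸ j) * W (n ∸ j))) (^F-lowCoeff log1p refl m j j<m))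
    (solve 3 (λ b f w → b :* (f :* con 0ℚ) :* w := con 0ℚ) refl (ℕ→ℚ (n C j)) (fact j) (fact (n ∸ j) * W (n ∸ j)))

fact-*-stirlingSum : ∀ n m (U V : FPS) → m ≤ n →
  fact m * sumTo (n ∸ m) (λ l → sumTo (n ∸ m ∸ l) (λ a →
      ℕ→ℚ (n C (l + m)) * ℕ→ℚ ((n ∸ m ∸ l) C a) * S₁ (l + m) m
        * (fact a * U a) * (fact (n ∸ m ∸ l ∸ a) * V (n ∸ m ∸ l ∸ a))))
    ≡ fact n * ((log1p ^F m) ⊛ (U ⊛ V)) n
fact-*-stirlingSum n m U V m≤n =
  trans (cong (fact m *_) (sumTo-cong′ (n ∸ m) inner)) (fact-*-log1p^F-⊛ n m (U ⊛ V) m≤n)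
  where
  open ≡-Reasoning
  inner : ∀ l → let N = n ∸ m ∸ l in
    sumTo N (λ a → ℕ→ℚ (n C (l + m)) * ℕ→ℚ (N C a) * S₁ (l + m) m * (fact a * U a) * (fact (N ∸ a) * V (N ∸ a)))
      ≡ ℕ→ℚ (n C (l + m)) * S₁ (l + m) m * (fact N * (U ⊛ V) N)
  inner l = begin
    sumTo N (λ a → b * ℕ→ℚ (N C a) * s * (fact a * U a) * (fact (N ∸ a) * V (N ∸ a)))
      ≡⟨ sumTo-cong′ N (λ a → solve 5 (λ b q s u v → b :* q :* s :* u :* v := (b :* s) :* (q :* u :* v)) refl
          b (ℕ→ℚ (N C a)) s (fact a * U a) (fact (N ∸ a) * V (N ∸ a))) ⟩
    sumTo N (λ a → b * s * (ℕ→ℚ (N C a) * (fact a * U a) * (fact (N ∸ a) * V (N ∸ a))))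
      ≡⟨ sumTo-*ˡ N (b * s) _ ⟨
    b * s * sumTo N (λ a → ℕ→ℚ (N C a) * (fact a * U a) * (fact (N ∸ a) * V (N ∸ a)))
      ≡⟨ cong (b * s *_) (fact-*-⊛ U V N) ⟨
    b * s * (fact N * (U ⊛ V) N) ∎
    where
    N = n ∸ m ∸ l
    b = ℕ→ℚ (n C (l + m))
    s = S₁ (l + m) m

cauchyBernoulliCoeff : ℤ → ℤ → ℕ → ℕ → ℚ
cauchyBernoulliCoeff k r n m = negOnePow m *
  sumTo (n ∸ m) (λ l → sumTo (n ∸ m ∸ l) (λ a →
    ℕ→ℚ (n C (l + m)) * ℕ→ℚ ((n ∸ m ∸ l) C a) * S₁ (l + m) m
      * CarlitzBeta r a (- ℤ→ℚ r) * Cauchy k (n ∸ m ∸ l ∸ a)))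

fact-*-bernoulliTerm : ∀ k r x n m → m ≤ n →
  fact n * (bernoulliGF r x m * ((negLog1p ^F m) ⊛ (carlitzGF r (- ℤ→ℚ r) ⊛ cauchyGF k 0ℚ)) n)
    ≡ cauchyBernoulliCoeff k r n m * BernoulliPoly r m x
fact-*-bernoulliTerm k r x n m m≤n = begin
  fact n * (b * ((negLog1p ^F m) ⊛ W) n)
    ≡⟨ cong (λ y → fact n * (b * y))
      (trans (⊛-congʳ W (negLog1p-^F m) n) (·-⊛ (negOnePow m) (log1p ^F m) W n)) ⟩
  fact n * (b * (negOnePow m * y))
    ≡⟨ solve 4 (λ f b s y → f :* (b :* (s :* y)) := s :* b :* (f :* y)) refl
      (fact n) b (negOnePow m) y ⟩
  negOnePow m * b * (fact n * y)
    ≡⟨ cong (negOnePow m * b *_) (fact-*-stirlingSum n m U V m≤n) ⟨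
  negOnePow m * b * (fact m * T)
    ≡⟨ solve 4 (λ s b f t → s :* b :* (f :* t) := (s :* t) :* (f :* b)) refl
      (negOnePow m) b (fact m) T ⟩
  cauchyBernoulliCoeff k r n m * BernoulliPoly r m x ∎
  where
  open ≡-Reasoning
  U = carlitzGF r (- ℤ→ℚ r)
  V = cauchyGF k 0ℚ
  W = U ⊛ V
  b = bernoulliGF r x m
  y = ((log1p ^F m) ⊛ W) n
  T = sumTo (n ∸ m) (λ l → sumTo (n ∸ m ∸ l) (λ a →
        ℕ→ℚ (n C (l + m)) * ℕ→ℚ ((n ∸ m ∸ l) C a) * S₁ (l + m) m
          * (fact a * U a) * (fact (n ∸ m ∸ l ∸ a) * V (n ∸ m ∸ l ∸ a))))

theorem8 : (k r : ℤ) (n : ℕ) (x : ℚ) →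
    CauchyPoly k n x ≡
      sumTo n (λ m →
        (negOnePow m *
          sumTo (n ∸ m) (λ l →
            sumTo (n ∸ m ∸ l) (λ a →
              ℕ→ℚ (n C (l + m)) * ℕ→ℚ ((n ∸ m ∸ l) C a) * S₁ (l + m) m
                * CarlitzBeta r a (- ℤ→ℚ r) * Cauchy k (n ∸ m ∸ l ∸ a))))
        * BernoulliPoly r m x)
theorem8 k r n x = begin
  fact n * cauchyGF k x n
    ≡⟨ cong (fact n *_) (cauchyGF-factorisation k r x n) ⟩
  fact n * (compose (bernoulliGF r x) negLog1p ⊛ W) n
    ≡⟨ cong (fact n *_) (compose-⊛-coeff (bernoulliGF r x) negLog1p W refl n) ⟩
  fact n * sumTo n (λ m → bernoulliGF r x m * ((negLog1p ^F m) ⊛ W) n)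
                                                                ≡⟨ sumTo-*ˡ n (fact n) _ ⟩
  sumTo n (λ m → fact n * (bernoulliGF r x m * ((negLog1p ^F m) ⊛ W) n))
                                                                ≡⟨ sumTo-cong n (fact-*-bernoulliTerm k r x n) ⟩
  sumTo n (λ m → cauchyBernoulliCoeff k r n m * BernoulliPoly r m x) ∎
  where
  open ≡-Reasoning
  W = carlitzGF r (- ℤ→ℚ r) ⊛ cauchyGF k 0ℚ
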